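{- Let $D$ be an $h$-layer $S$-$T$ DAG with capacities $U$ and let $\alpha\in[0,1]$. Any $\alpha$-blocking $S$-$T$ flow in $D$ is $\frac{\alpha}{h}$-approximate.
   Context: $D=(V,A)$ with capacities $U_a\ge0$. $D$ is an $S$-$T$ DAG if $v$ has no in-arcs iff $v\in S$ and no out-arcs iff $v\in T$; it is $h$-layer if $V$ can be partitioned $S=V_1\sqcup\dots\sqcup V_{h+1}=T$ with every arc from some $V_i$ to some $V_j$, $j>i$. A flow assigns $f_a\in[0,U_a]$ to arcs; it is an $S$-$T$ flow if inflow equals outflow at every $v\notin S\cup T$; $\text{val}(f)=\sum_{s\in S}\sum_{a\in\delta^+(s)}f_a$. An $S$-$T$ flow $f$ is $\alpha$-blocking if every directed $S$ to $T$ path contains an arc $a$ with $f_a\ge\alpha U_a$, and is $\beta$-approximate if $\text{val}(f)\ge\beta\,\text{val}(f^*)$ for a maximum-value $S$-$T$ flow $f^*$.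
   Formalization: The capacities U, the parameter α and all flow values, including those of the maximum-value S-T flow, are rational. -}

module Defs where

open import Data.Nat as ℕ using (ℕ; suc; NonZero)
open import Data.Fin using (Fin; zero; fromℕ)
open import Data.Fin.Subset using (Subset; _∈_; _∉_)
open import Data.Vec using (lookup)
open import Data.List using (List; []; _∷_; map; foldr)
open import Data.List.Base using (allFin)
open import Data.Integer using (+_)
open import Data.Rational using (ℚ; 0ℚ; 1ℚ; _+_; _*_; _≤_; _/_)
open import Data.Bool using (if_then_else_)
open import Data.Product using (Σ; _×_; ∃-syntax)
open import Data.Empty using (⊥)
open import Function.Bundles using (_⇔_)
open import Relation.Binary.PropositionalEquality using (_≡_; _≢_)
open import Relation.Nullary using (¬_; does)
open import Data.Fin using (_≟_)
open import Data.List.Membership.Propositional using () renaming (_∈_ to _∈ᴸ_)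

record Digraph : Set where
  field
    n m  : ℕ
    tail : Fin m → Fin n
    head : Fin m → Fin n
open Digraph public

sumℚ : List ℚ → ℚ
sumℚ = foldr _+_ 0ℚ

module _ (D : Digraph) where
  private
    V = Fin (n D)
    A = Fin (m D)

  NoInArcs NoOutArcs : V → Set
  NoInArcs v  = ∀ (a : A) → head D a ≢ v
  NoOutArcs v = ∀ (a : A) → tail D a ≢ v

  IsSTDAG : Subset (n D) → Subset (n D) → Set
  IsSTDAG S T = ∀ (v : V) → (NoInArcs v ⇔ v ∈ S) × (NoOutArcs v ⇔ v ∈ T)

  -- D is h-layer: V partitioned into V_1,...,V_{h+1} (layer function L
  -- with values 0..h), V_1 = S, V_{h+1} = T, every arc goes from a layer
  -- to a strictly higher one.
  IsLayered : ℕ → Subset (n D) → Subset (n D) → Set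
  IsLayered h S T =
    Σ (V → Fin (suc h)) λ L →
      (∀ v → (L v ≡ zero ⇔ v ∈ S)) ×
      (∀ v → (L v ≡ fromℕ h ⇔ v ∈ T)) ×
      (∀ (a : A) → Data.Fin._<_ (L (tail D a)) (L (head D a)))

  inflow outflow : (A → ℚ) → V → ℚ
  inflow  f v = sumℚ (map (λ a → if does (head D a ≟ v) then f a else 0ℚ) (allFin (m D)))
  outflow f v = sumℚ (map (λ a → if does (tail D a ≟ v) then f a else 0ℚ) (allFin (m D)))

  IsFlow : (U f : A → ℚ) → Set
  IsFlow U f = ∀ a → (0ℚ ≤ f a) × (f a ≤ U a)

  IsSTFlow : Subset (n D) → Subset (n D) → (U f : A → ℚ) → Set
  IsSTFlow S T U f = IsFlow U f × (∀ v → v ∉ S → v ∉ T → inflow f v ≡ outflow f v)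

  val : Subset (n D) → (A → ℚ) → ℚ
  val S f = sumℚ (map (λ s → if lookup S s then outflow f s else 0ℚ) (allFin (n D)))

  data Path : V → V → Set where
    arc  : (a : A) → Path (tail D a) (head D a)
    _∷ₚ_ : (a : A) → {w : V} → Path (head D a) w → Path (tail D a) w

  arcs : ∀ {u w} → Path u w → List A
  arcs (arc a)    = a ∷ []
  arcs (a ∷ₚ p)   = a ∷ arcs p

  IsBlocking : Subset (n D) → Subset (n D) → (U f : A → ℚ) → ℚ → Set
  IsBlocking S T U f α =
    ∀ (s t : V) → s ∈ S → t ∈ T → (p : Path s t) →
      ∃[ a ] (a ∈ᴸ arcs p × α * U a ≤ f a)

  IsMaxSTFlow : Subset (n D) → Subset (n D) → (U f : A → ℚ) → Set
  IsMaxSTFlow S T U f = IsSTFlow S T U f × (∀ g → IsSTFlow S T U g → val S g ≤ val S f)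

  IsApproximate : Subset (n D) → Subset (n D) → (U f : A → ℚ) → ℚ → Set
  IsApproximate S T U f β =
    ∀ fstar → IsMaxSTFlow S T U fstar → β * val S fstar ≤ val S f

_/ℚ_ : ℚ → (h : ℕ) → .{{_ : NonZero h}} → ℚ
α /ℚ h = α * ((+ 1) / h)

-- If a potential π is c on S and 0 on T, flow conservation gives, for every S-T flow g,
--   Σₐ gₐ (π (tail a) - π (head a)) = c · val g,
-- so arc-wise bounds on gₐ (π (tail a) - π (head a)) bound c · val g from either side.
-- Let Y be the set of vertices that reach T along arcs with fₐ < α Uₐ. As f is α-blocking,
-- Y misses S, and every arc entering Y has α Uₐ ≤ fₐ; the indicator of the complement of Y
-- then gives α · val f* ≤ α · cap Y ≤ Σₐ fₐ. The potential h - layer drops by at least 1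
-- along every arc, which gives Σₐ fₐ ≤ h · val f.
module Submission where

open import Defs
open import Data.Nat using (ℕ; NonZero)
open import Data.Fin.Subset using (Subset)
open import Data.Fin using (Fin)
open import Data.Rational using (ℚ; 0ℚ; 1ℚ; _≤_)
open import Data.Product using (_×_)

open import Algebra.Bundles using (Ring)
open import Data.Bool using (Bool; true; false; not; _∧_; if_then_else_)
open import Data.Empty using (⊥-elim)
open import Data.Fin using (zero; suc; toℕ; fromℕ; _≟_; _<_)
open import Data.Fin.Properties using (any?; toℕ≤pred[n]; toℕ-fromℕ)
open import Data.Fin.Subset using (_∈_; _∉_)
open import Data.Fin.Subset.Properties using (_∈?_)
open import Data.Integer as ℤ using (1ℤ)
open import Data.List using (map; tabulate; allFin)
open import Data.List.Properties using (map-tabulate)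
open import Data.List.Relation.Unary.All as All using (All; []; _∷_)
open import Data.Nat as ℕ using (suc; zero; _∸_)
import Data.Nat.Properties as ℕₚ
import Data.Integer.Properties as ℤₚ
open import Data.Product using (Σ; ∃-syntax; _,_; proj₁; proj₂)
open import Data.Rational using (_+_; _*_; -_; _/_; 1/_; nonNegative)
open import Data.Rational.Literals using (fromℤ)
import Data.Rational.Properties as ℚₚ
open import Data.Rational.Properties using (≤-refl; ≤-reflexive; ≤-trans; +-mono-≤; +-monoʳ-≤; *-monoˡ-≤-nonNeg; *-monoʳ-≤-nonNeg; +-identityˡ; +-identityʳ; *-identityˡ; *-zeroˡ; *-zeroʳ; *-comm; *-assoc)
import Data.Rational.Unnormalised as ℚᵘ
import Data.Rational.Unnormalised.Properties as ℚᵘₚ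
open import Data.Sum using (_⊎_; inj₁; inj₂)
open import Data.Vec using (lookup)
open import Data.Vec.Properties using ([]=⇒lookup; lookup⇒[]=)
open import Function using (_∘_; id; _$_)
open import Function.Bundles using (Equivalence)
open import Relation.Binary.PropositionalEquality using (_≡_; _≢_; refl; sym; trans; cong; cong₂; module ≡-Reasoning)
open import Relation.Nullary using (¬_; Dec; yes; no; does)
open import Relation.Nullary.Decidable using (_×-dec_; _⊎-dec_; ¬?; dec-true; dec-false; decidable-stable)
open import Relation.Unary using (Pred; Decidable)
open import Level using (0ℓ)

open import Algebra.Properties.Semiring.Sum (Ring.semiring ℚₚ.+-*-ring)
  using (sum; sum-syntax; sum-cong-≗; sum-replicate-zero; ∑-distrib-+; ∑-comm; *-distribˡ-sum)
open import Algebra.Properties.Group ℚₚ.+-0-group using (\\-leftDividesʳ)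
open import Algebra.Definitions.RawMonoid Data.Rational.+-0-rawMonoid using () renaming (_×_ to _×ℚ_)

select : Bool → ℚ → ℚ
select b x = if b then x else 0ℚ

*-select : ∀ b c x → c * select b x ≡ select b (c * x)
*-select true  c x = refl
*-select false c x = *-zeroʳ c

select-¬ : ∀ {P : Set} (P? : Dec P) → ¬ P → ∀ x → select (does P?) x ≡ 0ℚ
select-¬ (yes p) ¬p x = ⊥-elim (¬p p)
select-¬ (no _)  ¬p x = refl

+-cancelˡ-≤ : ∀ r {p q} → r + p ≤ r + q → p ≤ q
+-cancelˡ-≤ r {p} {q} r+p≤r+q = begin
  p              ≡⟨ \\-leftDividesʳ r p ⟨
  - r + (r + p)  ≤⟨ +-monoʳ-≤ (- r) r+p≤r+q ⟩
  - r + (r + q)  ≡⟨ \\-leftDividesʳ r q ⟩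
  q              ∎
  where open ℚₚ.≤-Reasoning

sumℚ-tabulate : ∀ {k} (F : Fin k → ℚ) → sumℚ (tabulate F) ≡ sum F
sumℚ-tabulate {zero}  F = refl
sumℚ-tabulate {suc k} F = cong (F zero +_) (sumℚ-tabulate (F ∘ suc))

sumℚ-map-allFin : ∀ {k} (F : Fin k → ℚ) → sumℚ (map F (allFin k)) ≡ sum F
sumℚ-map-allFin F = trans (cong sumℚ (map-tabulate id F)) (sumℚ-tabulate F)

sum-mono-≤ : ∀ {k} {F G : Fin k → ℚ} → (∀ i → F i ≤ G i) → sum F ≤ sum G
sum-mono-≤ {zero}  F≤G = ≤-refl
sum-mono-≤ {suc k} F≤G = +-mono-≤ (F≤G zero) (sum-mono-≤ (F≤G ∘ suc))

sum-select-≟ : ∀ {k} (w : Fin k) (F : Fin k → ℚ) → ∑[ v < k ] select (does (w ≟ v)) (F v) ≡ F w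
sum-select-≟ {suc k} zero    F = trans (cong (F zero +_) (sum-replicate-zero k)) (+-identityʳ (F zero))
sum-select-≟ {suc k} (suc w) F = trans (+-identityˡ _) (sum-select-≟ w (F ∘ suc))

fibreSum : ∀ {k l} → (Fin l → Fin k) → (Fin l → ℚ) → Fin k → ℚ
fibreSum {l = l} p g v = sumℚ (map (λ a → select (does (p a ≟ v)) (g a)) (allFin l))

fibreSum≡∑ : ∀ {k l} (p : Fin l → Fin k) (g : Fin l → ℚ) v →
            fibreSum p g v ≡ ∑[ a < l ] select (does (p a ≟ v)) (g a)
fibreSum≡∑ p g v = sumℚ-map-allFin (λ a → select (does (p a ≟ v)) (g a))

fibreSum-empty : ∀ {k l} {p : Fin l → Fin k} {v} (g : Fin l → ℚ) → (∀ a → p a ≢ v) → fibreSum p g v ≡ 0ℚ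
fibreSum-empty {l = l} {p} {v} g v∉im = begin
  fibreSum p g v                            ≡⟨ fibreSum≡∑ p g v ⟩
  ∑[ a < l ] select (does (p a ≟ v)) (g a)  ≡⟨ sum-cong-≗ (λ a → select-¬ (p a ≟ v) (v∉im a) (g a)) ⟩
  ∑[ a < l ] 0ℚ                             ≡⟨ sum-replicate-zero l ⟩
  0ℚ                                        ∎
  where open ≡-Reasoning

∑-*-fibreSum : ∀ {k l} (p : Fin l → Fin k) (π : Fin k → ℚ) (g : Fin l → ℚ) →
               ∑[ v < k ] (π v * fibreSum p g v) ≡ ∑[ a < l ] (π (p a) * g a)
∑-*-fibreSum {k} {l} p π g = begin
  ∑[ v < k ] (π v * fibreSum p g v)
    ≡⟨ sum-cong-≗ (λ v → trans (cong (π v *_) (fibreSum≡∑ p g v)) (*-distribˡ-sum (π v) (λ a → select (does (p a ≟ v)) (g a)))) ⟩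
  ∑[ v < k ] ∑[ a < l ] (π v * select (does (p a ≟ v)) (g a))
    ≡⟨ ∑-comm (λ v a → π v * select (does (p a ≟ v)) (g a)) ⟩
  ∑[ a < l ] ∑[ v < k ] (π v * select (does (p a ≟ v)) (g a))
    ≡⟨ sum-cong-≗ (λ a → sum-cong-≗ (λ v → *-select (does (p a ≟ v)) (π v) (g a))) ⟩
  ∑[ a < l ] ∑[ v < k ] select (does (p a ≟ v)) (π v * g a)
    ≡⟨ sum-cong-≗ (λ a → sum-select-≟ (p a) (λ v → π v * g a)) ⟩
  ∑[ a < l ] (π (p a) * g a)
    ∎
  where open ≡-Reasoning

lookup≡false⇒∉ : ∀ {k} {P : Subset k} {v} → lookup P v ≡ false → v ∉ P
lookup≡false⇒∉ P[v]≡false v∈P with () ← trans (sym ([]=⇒lookup v∈P)) P[v]≡false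

module Potential (D : Digraph) {S T : Subset (n D)} (isSTDAG : IsSTDAG D S T)
  {g : Fin (m D) → ℚ} (conserves : ∀ v → v ∉ S → v ∉ T → inflow D g v ≡ outflow D g v)
  (π : Fin (n D) → ℚ) {c : ℚ} (π≡c-on-S : ∀ v → v ∈ S → π v ≡ c) (π≡0-on-T : ∀ v → v ∈ T → π v ≡ 0ℚ)
  where

  vertex-balance : ∀ v → π v * inflow D g v + c * select (lookup S v) (outflow D g v) ≡ π v * outflow D g v
  vertex-balance v with lookup S v in S[v] | lookup T v in T[v]
  ... | true | _ = begin
    π v * inflow D g v + c * outflow D g v  ≡⟨ cong (λ x → π v * x + c * outflow D g v) no-inflow ⟩
    π v * 0ℚ + c * outflow D g v            ≡⟨ cong (_+ c * outflow D g v) (*-zeroʳ (π v)) ⟩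
    0ℚ + c * outflow D g v                  ≡⟨ +-identityˡ _ ⟩
    c * outflow D g v                       ≡⟨ cong (_* outflow D g v) (π≡c-on-S v v∈S) ⟨
    π v * outflow D g v                     ∎
    where
    open ≡-Reasoning
    v∈S : v ∈ S
    v∈S = lookup⇒[]= v S S[v]
    no-inflow : inflow D g v ≡ 0ℚ
    no-inflow = fibreSum-empty g (Equivalence.from (proj₁ (isSTDAG v)) v∈S)
  ... | false | true = begin
    π v * inflow D g v + c * 0ℚ  ≡⟨ cong₂ _+_ (cong (_* inflow D g v) πv≡0) (*-zeroʳ c) ⟩
    0ℚ * inflow D g v + 0ℚ       ≡⟨ +-identityʳ _ ⟩
    0ℚ * inflow D g v            ≡⟨ *-zeroˡ (inflow D g v) ⟩
    0ℚ                           ≡⟨ *-zeroˡ (outflow D g v) ⟨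
    0ℚ * outflow D g v           ≡⟨ cong (_* outflow D g v) πv≡0 ⟨
    π v * outflow D g v          ∎
    where
    open ≡-Reasoning
    πv≡0 : π v ≡ 0ℚ
    πv≡0 = π≡0-on-T v (lookup⇒[]= v T T[v])
  ... | false | false = begin
    π v * inflow D g v + c * 0ℚ  ≡⟨ cong₂ _+_ (cong (π v *_) conserved) (*-zeroʳ c) ⟩
    π v * outflow D g v + 0ℚ     ≡⟨ +-identityʳ _ ⟩
    π v * outflow D g v          ∎
    where
    open ≡-Reasoning
    conserved : inflow D g v ≡ outflow D g v
    conserved = conserves v (lookup≡false⇒∉ S[v]) (lookup≡false⇒∉ T[v])

  potential-balance : ∑[ a < m D ] (π (head D a) * g a) + c * val D S g ≡ ∑[ a < m D ] (π (tail D a) * g a)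
  potential-balance = begin
    ∑[ a < m D ] (π (head D a) * g a) + c * val D S g
      ≡⟨ cong₂ _+_ (sym (∑-*-fibreSum (head D) π g)) (cong (c *_) (sumℚ-map-allFin source-outflow)) ⟩
    ∑[ v < n D ] (π v * inflow D g v) + c * sum source-outflow
      ≡⟨ cong (∑[ v < n D ] (π v * inflow D g v) +_) (*-distribˡ-sum c source-outflow) ⟩
    ∑[ v < n D ] (π v * inflow D g v) + ∑[ v < n D ] (c * source-outflow v)
      ≡⟨ ∑-distrib-+ (λ v → π v * inflow D g v) (λ v → c * source-outflow v) ⟨
    ∑[ v < n D ] (π v * inflow D g v + c * source-outflow v)
      ≡⟨ sum-cong-≗ vertex-balance ⟩
    ∑[ v < n D ] (π v * outflow D g v)
      ≡⟨ ∑-*-fibreSum (tail D) π g ⟩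
    ∑[ a < m D ] (π (tail D a) * g a)
      ∎
    where
    open ≡-Reasoning
    source-outflow : Fin (n D) → ℚ
    source-outflow v = select (lookup S v) (outflow D g v)

  c*val≤∑ : {w : Fin (m D) → ℚ} → (∀ a → π (tail D a) * g a ≤ π (head D a) * g a + w a) →
            c * val D S g ≤ sum w
  c*val≤∑ {w} bound = +-cancelˡ-≤ (∑[ a < m D ] (π (head D a) * g a)) $ begin
    ∑[ a < m D ] (π (head D a) * g a) + c * val D S g  ≡⟨ potential-balance ⟩
    ∑[ a < m D ] (π (tail D a) * g a)                  ≤⟨ sum-mono-≤ bound ⟩
    ∑[ a < m D ] (π (head D a) * g a + w a)            ≡⟨ ∑-distrib-+ (λ a → π (head D a) * g a) w ⟩
    ∑[ a < m D ] (π (head D a) * g a) + sum w          ∎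
    where open ℚₚ.≤-Reasoning

  ∑≤c*val : {w : Fin (m D) → ℚ} → (∀ a → π (head D a) * g a + w a ≤ π (tail D a) * g a) →
            sum w ≤ c * val D S g
  ∑≤c*val {w} bound = +-cancelˡ-≤ (∑[ a < m D ] (π (head D a) * g a)) $ begin
    ∑[ a < m D ] (π (head D a) * g a) + sum w          ≡⟨ ∑-distrib-+ (λ a → π (head D a) * g a) w ⟨
    ∑[ a < m D ] (π (head D a) * g a + w a)            ≤⟨ sum-mono-≤ bound ⟩
    ∑[ a < m D ] (π (tail D a) * g a)                  ≡⟨ potential-balance ⟨
    ∑[ a < m D ] (π (head D a) * g a) + c * val D S g  ∎
    where open ℚₚ.≤-Reasoning

IsSTCut : (D : Digraph) → Subset (n D) → Subset (n D) → (Fin (n D) → Bool) → Set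
IsSTCut D S T Y = (∀ v → v ∈ S → Y v ≡ false) × (∀ v → v ∈ T → Y v ≡ true)

cutCapacity : (D : Digraph) → (Fin (n D) → Bool) → (Fin (m D) → ℚ) → ℚ
cutCapacity D Y U = ∑[ a < m D ] select (not (Y (tail D a)) ∧ Y (head D a)) (U a)

arc-cut-bound : ∀ {x u} → 0ℚ ≤ x → x ≤ u → ∀ bt bh →
                select (not bt) 1ℚ * x ≤ select (not bh) 1ℚ * x + select (not bt ∧ bh) u
arc-cut-bound {x} {u} 0≤x x≤u true true = ≤-reflexive (sym (+-identityʳ (0ℚ * x)))
arc-cut-bound {x} {u} 0≤x x≤u true false = begin
  0ℚ * x        ≡⟨ *-zeroˡ x ⟩
  0ℚ            ≤⟨ 0≤x ⟩
  x             ≡⟨ trans (+-identityʳ (1ℚ * x)) (*-identityˡ x) ⟨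
  1ℚ * x + 0ℚ   ∎
  where open ℚₚ.≤-Reasoning
arc-cut-bound {x} {u} 0≤x x≤u false true = begin
  1ℚ * x        ≡⟨ *-identityˡ x ⟩
  x             ≤⟨ x≤u ⟩
  u             ≡⟨ trans (cong (_+ u) (*-zeroˡ x)) (+-identityˡ u) ⟨
  0ℚ * x + u    ∎
  where open ℚₚ.≤-Reasoning
arc-cut-bound {x} {u} 0≤x x≤u false false = ≤-reflexive (sym (+-identityʳ (1ℚ * x)))

val≤cutCapacity : ∀ (D : Digraph) {S T U g} → IsSTDAG D S T → IsSTFlow D S T U g →
                  ∀ {Y} → IsSTCut D S T Y → val D S g ≤ cutCapacity D Y U
val≤cutCapacity D {S} {T} {U} {g} isSTDAG (isFlow , conserves) {Y} (S∩Y≡∅ , T⊆Y) = begin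
  val D S g          ≡⟨ *-identityˡ (val D S g) ⟨
  1ℚ * val D S g     ≤⟨ c*val≤∑ arc-bound ⟩
  cutCapacity D Y U  ∎
  where
  open ℚₚ.≤-Reasoning
  source-side : Fin (n D) → ℚ
  source-side v = select (not (Y v)) 1ℚ
  open Potential D isSTDAG conserves source-side
         (λ v v∈S → cong (λ b → select (not b) 1ℚ) (S∩Y≡∅ v v∈S))
         (λ v v∈T → cong (λ b → select (not b) 1ℚ) (T⊆Y v v∈T))
  arc-bound : ∀ a → source-side (tail D a) * g a ≤
                    source-side (head D a) * g a + select (not (Y (tail D a)) ∧ Y (head D a)) (U a)
  arc-bound a = arc-cut-bound (proj₁ (isFlow a)) (proj₂ (isFlow a)) (Y (tail D a)) (Y (head D a))

×-nonNeg : ∀ {x} → 0ℚ ≤ x → ∀ i → 0ℚ ≤ i ×ℚ x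
×-nonNeg 0≤x zero    = ≤-refl
×-nonNeg 0≤x (suc i) = +-mono-≤ 0≤x (×-nonNeg 0≤x i)

×-monoˡ-≤ : ∀ {x} → 0ℚ ≤ x → ∀ {i j} → i ℕ.≤ j → i ×ℚ x ≤ j ×ℚ x
×-monoˡ-≤ 0≤x {j = j} ℕ.z≤n     = ×-nonNeg 0≤x j
×-monoˡ-≤ {x} 0≤x     (ℕ.s≤s i≤j) = +-monoʳ-≤ x (×-monoˡ-≤ 0≤x i≤j)

×1-*-step : ∀ {x} → 0ℚ ≤ x → ∀ {i j} → i ℕ.< j → (i ×ℚ 1ℚ) * x + x ≤ (j ×ℚ 1ℚ) * x
×1-*-step {x} 0≤x {i} {j} i<j = begin
  (i ×ℚ 1ℚ) * x + x       ≡⟨ ℚₚ.+-comm _ x ⟩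
  x + (i ×ℚ 1ℚ) * x       ≡⟨ cong (_+ (i ×ℚ 1ℚ) * x) (*-identityˡ x) ⟨
  1ℚ * x + (i ×ℚ 1ℚ) * x  ≡⟨ ℚₚ.*-distribʳ-+ x 1ℚ (i ×ℚ 1ℚ) ⟨
  (suc i ×ℚ 1ℚ) * x       ≤⟨ *-monoʳ-≤-nonNeg x {{nonNegative 0≤x}} (×-monoˡ-≤ (ℚₚ.nonNegative⁻¹ 1ℚ) i<j) ⟩
  (j ×ℚ 1ℚ) * x           ∎
  where open ℚₚ.≤-Reasoning

1+fromℤ : ∀ k → 1ℚ + fromℤ (ℤ.+ k) ≡ fromℤ (ℤ.+ suc k)
1+fromℤ k = ℚₚ.toℚᵘ-injective (ℚᵘₚ.≃-trans (ℚₚ.toℚᵘ-homo-+ 1ℚ (fromℤ (ℤ.+ k))) (ℚᵘ.*≡*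
  (trans (ℤₚ.*-identityʳ _) (trans (cong (ℤ._+_ 1ℤ) (ℤₚ.*-identityʳ (ℤ.+ k))) (sym (ℤₚ.*-identityʳ (ℤ.+ suc k)))))))

×1≡fromℤ : ∀ k → k ×ℚ 1ℚ ≡ fromℤ (ℤ.+ k)
×1≡fromℤ zero    = refl
×1≡fromℤ (suc k) = trans (cong (1ℚ +_) (×1≡fromℤ k)) (1+fromℤ k)

1/n*[n×1]≡1 : ∀ k .{{_ : NonZero k}} → (1ℤ / k) * (k ×ℚ 1ℚ) ≡ 1ℚ
1/n*[n×1]≡1 (suc k) = begin
  (1ℤ / suc k) * (suc k ×ℚ 1ℚ)                  ≡⟨ cong₂ _*_ (ℚₚ.↥p/↧p≡p (1/ fromℤ (ℤ.+ suc k))) (×1≡fromℤ (suc k)) ⟩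
  (1/ fromℤ (ℤ.+ suc k)) * fromℤ (ℤ.+ suc k)   ≡⟨ ℚₚ.*-inverseˡ (fromℤ (ℤ.+ suc k)) ⟩
  1ℚ                                            ∎
  where open ≡-Reasoning

∑≤layers*val : ∀ (D : Digraph) {S T h U g} → IsSTDAG D S T → IsLayered D h S T → IsSTFlow D S T U g →
               sum g ≤ (h ×ℚ 1ℚ) * val D S g
∑≤layers*val D {S} {T} {h} isSTDAG (L , L≡0⇔S , L≡h⇔T , L-increasing) (isFlow , conserves) =
  ∑≤c*val (λ a → ×1-*-step (proj₁ (isFlow a)) (height-decreasing a))
  where
  height : Fin (n D) → ℕ
  height v = h ∸ toℕ (L v)
  height≡h-on-S : ∀ v → v ∈ S → height v ×ℚ 1ℚ ≡ h ×ℚ 1ℚ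
  height≡h-on-S v v∈S = cong (λ i → (h ∸ toℕ i) ×ℚ 1ℚ) (Equivalence.from (L≡0⇔S v) v∈S)
  height≡0-on-T : ∀ v → v ∈ T → height v ≡ 0
  height≡0-on-T v v∈T = begin
    h ∸ toℕ (L v)         ≡⟨ cong (λ i → h ∸ toℕ i) (Equivalence.from (L≡h⇔T v) v∈T) ⟩
    h ∸ toℕ (fromℕ h)     ≡⟨ cong (h ∸_) (toℕ-fromℕ h) ⟩
    h ∸ h                 ≡⟨ ℕₚ.n∸n≡0 h ⟩
    0                     ∎
    where open ≡-Reasoning
  height-decreasing : ∀ a → height (head D a) ℕ.< height (tail D a)
  height-decreasing a = ℕₚ.∸-monoʳ-< (L-increasing a) (toℕ≤pred[n] (L (head D a)))
  open Potential D isSTDAG conserves (λ v → height v ×ℚ 1ℚ) height≡h-on-S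
         (λ v v∈T → cong (_×ℚ 1ℚ) (height≡0-on-T v v∈T))

module Reachability (D : Digraph) (T : Subset (n D)) {h} (L : Fin (n D) → Fin (suc h))
  (L-increasing : ∀ a → L (tail D a) < L (head D a))
  {Blocked : Pred (Fin (m D)) 0ℓ} (blocked? : Decidable Blocked) where

  -- A path has at most h arcs, so bounding its length by h loses nothing and keeps
  -- reachability decidable.
  ReachesWithin : ℕ → Fin (n D) → Set
  ReachesWithin zero    v = v ∈ T
  ReachesWithin (suc k) v =
    ReachesWithin k v ⊎ ∃[ a ] (tail D a ≡ v × ¬ Blocked a × ReachesWithin k (head D a))

  reachesWithin? : ∀ k → Decidable (ReachesWithin k)
  reachesWithin? zero    v = v ∈? T
  reachesWithin? (suc k) v = reachesWithin? k v ⊎-dec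
    any? (λ a → (tail D a ≟ v) ×-dec ¬? (blocked? a) ×-dec reachesWithin? k (head D a))

  ∈T⇒reachesWithin : ∀ k {v} → v ∈ T → ReachesWithin k v
  ∈T⇒reachesWithin zero    v∈T = v∈T
  ∈T⇒reachesWithin (suc k) v∈T = inj₁ (∈T⇒reachesWithin k v∈T)

  reachesWithin-saturated : ∀ k {v} → ReachesWithin k v → ∀ j → h ℕ.≤ j ℕ.+ toℕ (L v) → ReachesWithin j v
  reachesWithin-saturated zero    v∈T                         j       _   = ∈T⇒reachesWithin j v∈T
  reachesWithin-saturated (suc k) (inj₁ r)                    j       h≤  = reachesWithin-saturated k r j h≤
  reachesWithin-saturated (suc k) (inj₂ (a , refl , ¬b , r)) zero    h≤  =
    ⊥-elim (ℕₚ.<⇒≱ (ℕₚ.<-≤-trans (L-increasing a) (toℕ≤pred[n] (L (head D a)))) h≤)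
  reachesWithin-saturated (suc k) (inj₂ (a , refl , ¬b , r)) (suc j) h≤  =
    inj₂ (a , refl , ¬b , reachesWithin-saturated k r j h≤′)
    where
    h≤′ : h ℕ.≤ j ℕ.+ toℕ (L (head D a))
    h≤′ = ℕₚ.≤-trans h≤ (ℕₚ.≤-trans (ℕₚ.≤-reflexive (sym (ℕₚ.+-suc j _))) (ℕₚ.+-monoʳ-≤ j (L-increasing a)))

  reaches-backwards : ∀ a → ¬ Blocked a → ReachesWithin h (head D a) → ReachesWithin h (tail D a)
  reaches-backwards a ¬b r = reachesWithin-saturated (suc h) (inj₂ (a , refl , ¬b , r)) h (ℕₚ.m≤m+n h _)

  reachesWithin⇒path : ∀ k {v} → ReachesWithin k v →
    v ∈ T ⊎ ∃[ t ] (t ∈ T × Σ (Path D v t) λ p → All (λ a → ¬ Blocked a) (arcs D p))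
  reachesWithin⇒path zero    v∈T      = inj₁ v∈T
  reachesWithin⇒path (suc k) (inj₁ r) = reachesWithin⇒path k r
  reachesWithin⇒path (suc k) (inj₂ (a , refl , ¬b , r)) with reachesWithin⇒path k r
  ... | inj₁ head∈T                 = inj₂ (head D a , head∈T , arc a , ¬b ∷ [])
  ... | inj₂ (t , t∈T , p , open-p) = inj₂ (t , t∈T , a ∷ₚ p , ¬b ∷ open-p)

blocking⇒cut : ∀ (D : Digraph) {S T h U f α} → (∀ v → v ∈ S → v ∉ T) → IsLayered D h S T →
               IsFlow D U f → IsBlocking D S T U f α →
               ∃[ Y ] (IsSTCut D S T Y × α * cutCapacity D Y U ≤ sum f)
blocking⇒cut D {S} {T} {h} {U} {f} {α} S∩T≡∅ (L , _ , _ , L-increasing) isFlow blocking =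
  Y , (S∩Y≡∅ , T⊆Y) , α*cap≤∑f
  where
  open Reachability D T L L-increasing (λ a → α * U a ℚₚ.≤? f a)

  Y : Fin (n D) → Bool
  Y v = does (reachesWithin? h v)

  S∩Y≡∅ : ∀ v → v ∈ S → Y v ≡ false
  S∩Y≡∅ v v∈S = dec-false (reachesWithin? h v) unreachable
    where
    unreachable : ¬ ReachesWithin h v
    unreachable r with reachesWithin⇒path h r
    ... | inj₁ v∈T = S∩T≡∅ v v∈S v∈T
    ... | inj₂ (t , t∈T , p , open-p) with blocking v t v∈S t∈T p
    ... | a , a∈p , blocked = All.lookup open-p a∈p blocked

  T⊆Y : ∀ v → v ∈ T → Y v ≡ true
  T⊆Y v v∈T = dec-true (reachesWithin? h v) (∈T⇒reachesWithin h v∈T)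

  α*entering≤f : ∀ a → α * select (not (does (reachesWithin? h (tail D a))) ∧ does (reachesWithin? h (head D a))) (U a)
                       ≤ f a
  α*entering≤f a with reachesWithin? h (tail D a) | reachesWithin? h (head D a)
  ... | no ¬rt | yes rh = decidable-stable (α * U a ℚₚ.≤? f a) (λ ¬b → ¬rt (reaches-backwards a ¬b rh))
  ... | yes _  | _      = ≤-trans (≤-reflexive (*-zeroʳ α)) (proj₁ (isFlow a))
  ... | no _   | no _   = ≤-trans (≤-reflexive (*-zeroʳ α)) (proj₁ (isFlow a))

  α*cap≤∑f : α * cutCapacity D Y U ≤ sum f
  α*cap≤∑f = ≤-trans (≤-reflexive (*-distribˡ-sum α (λ a → select (not (Y (tail D a)) ∧ Y (head D a)) (U a))))
                     (sum-mono-≤ α*entering≤f)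

layered-disjoint : ∀ (D : Digraph) {S T h} .{{_ : NonZero h}} → IsLayered D h S T → ∀ v → v ∈ S → v ∉ T
layered-disjoint D {h = h} (L , L≡0⇔S , L≡h⇔T , _) v v∈S v∈T = ℕ.≢-nonZero⁻¹ h $ begin
  h                  ≡⟨ toℕ-fromℕ h ⟨
  toℕ (fromℕ h)      ≡⟨ cong toℕ (Equivalence.from (L≡h⇔T v) v∈T) ⟨
  toℕ (L v)          ≡⟨ cong toℕ (Equivalence.from (L≡0⇔S v) v∈S) ⟩
  0                  ∎
  where open ≡-Reasoning

lemma9p4 : (D : Digraph) (S T : Subset (Digraph.n D)) (h : ℕ) .{{_ : NonZero h}}
    → IsSTDAG D S T → IsLayered D h S T
    → (U : Fin (Digraph.m D) → ℚ) → (∀ a → 0ℚ ≤ U a)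
    → (α : ℚ) → 0ℚ ≤ α → α ≤ 1ℚ
    → (f : Fin (Digraph.m D) → ℚ) → IsSTFlow D S T U f → IsBlocking D S T U f α
    → IsApproximate D S T U f (α /ℚ h)
lemma9p4 D S T h isSTDAG layered U _ α 0≤α _ f f-isSTFlow blocking f* (f*-isSTFlow , _)
  with blocking⇒cut D {α = α} (layered-disjoint D layered) layered (proj₁ f-isSTFlow) blocking
... | Y , isCut , α*cap≤∑f = begin
  (α /ℚ h) * val D S f*                ≡⟨ cong (_* val D S f*) (*-comm α (1ℤ / h)) ⟩
  (1ℤ / h) * α * val D S f*            ≡⟨ *-assoc (1ℤ / h) α (val D S f*) ⟩
  (1ℤ / h) * (α * val D S f*)          ≤⟨ *-monoˡ-≤-nonNeg (1ℤ / h) {{ℚₚ.normalize-nonNeg 1 h}} α*val[f*]≤h*val[f] ⟩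
  (1ℤ / h) * ((h ×ℚ 1ℚ) * val D S f)   ≡⟨ *-assoc (1ℤ / h) (h ×ℚ 1ℚ) (val D S f) ⟨
  (1ℤ / h) * (h ×ℚ 1ℚ) * val D S f     ≡⟨ cong (_* val D S f) (1/n*[n×1]≡1 h) ⟩
  1ℚ * val D S f                       ≡⟨ *-identityˡ (val D S f) ⟩
  val D S f                            ∎
  where
  open ℚₚ.≤-Reasoning
  α*val[f*]≤h*val[f] : α * val D S f* ≤ (h ×ℚ 1ℚ) * val D S f
  α*val[f*]≤h*val[f] = begin
    α * val D S f*         ≤⟨ *-monoˡ-≤-nonNeg α {{nonNegative 0≤α}} (val≤cutCapacity D isSTDAG f*-isSTFlow isCut) ⟩
    α * cutCapacity D Y U  ≤⟨ α*cap≤∑f ⟩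
    sum f                  ≤⟨ ∑≤layers*val D isSTDAG layered f-isSTFlow ⟩
    (h ×ℚ 1ℚ) * val D S f  ∎
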